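{- Let $\mathfrak{M}=(T,<,I,V)$ and $\mathfrak{M}'=(T',<',I',V')$ be models and $f$ a model p-morphism from $\mathfrak{M}$ to $\mathfrak{M}'$. Then for every couple $(t,\pi)$ of $\mathfrak{M}$ and every formula $\varphi$ (built from propositional variables with $\neg,\wedge,G,H,L$), $\mathfrak{M},(t,\pi)\models\varphi$ iff $\mathfrak{M}',f((t,\pi))\models\varphi$.
   Context: A tree is a pair $(T,<)$ with $<$ irreflexive, transitive and downward linear (if $b<a$ and $c<a$ then $b=c$, $b<c$ or $c<b$). A history is a $\subseteq$-maximal $<$-linear subset of $T$; $H_t$ is the set of histories containing $t$. An indistinguishability function assigns to each $t$ an equivalence relation $I_t$ on $H_t$ such that $hI_tk$ and $s<t$ imply $hI_sk$. $\Pi_t$ is the set of $I_t$-classes, $[h]_{I_s}$ the $I_s$-class of $h$. A frame is $(T,<,I)$; a model is $(T,<,I,V)$ where $V$ maps each propositional variable to a set of couples, couples being the elements of $\bigcup_{t\in T}(\{t\}\times\Pi_t)$. Satisfaction at $(t,\pi)$: $p$ iff $(t,\pi)\in V(p)$; Boolean clauses as usual; $G\varphi$ iff for each $h\in\pi$ and $s\in h$ with $t<s$, $\varphi$ holds at $(s,[h]_{I_s})$; $H\varphi$ iff for each $h\in\pi$ and $s\in h$ with $s<t$, $\varphi$ holds at $(s,[h]_{I_s})$; $L\varphi$ iff for each $\rho\in\Pi_t$, $\varphi$ holds at $(t,\rho)$. On couples: $(t,\pi)\prec(s,\rho)$ iff $t<s$ and $\pi\supseteq\rho$; $\succ$ is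 the converse of $\prec$; $(t,\pi)\sim(s,\rho)$ iff $t=s$; primed versions in the primed structure. A frame p-morphism from $(T,<,I)$ to $(T',<',I')$ is a function $f$ from couples to couples such that: (G-f) $(t,\pi)\prec(s,\rho)$ implies $f((t,\pi))\prec'f((s,\rho))$; (G-b) if $f((t,\pi))\prec'x'$ there is $(s,\rho)$ with $(t,\pi)\prec(s,\rho)$ and $f((s,\rho))=x'$; (H-b) if $f((t,\pi))\succ'x'$ there is $(s,\rho)$ with $(t,\pi)\succ(s,\rho)$ and $f((s,\rho))=x'$; (L-f) $(t,\pi)\sim(s,\rho)$ implies $f((t,\pi))\sim'f((s,\rho))$; (L-b) if $f((t,\pi))\sim'x'$ there is $(s,\rho)$ with $(t,\pi)\sim(s,\rho)$ and $f((s,\rho))=x'$. A model p-morphism from $\mathfrak{M}$ to $\mathfrak{M}'$ is a frame p-morphism between the underlying frames such that (PV) for every couple $(t,\pi)$ and every propositional variable $p$, $(t,\pi)\in V(p)$ iff $f((t,\pi))\in V'(p)$. -}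

module Defs where

open import Level using (0ℓ)
open import Data.Nat using (ℕ)
open import Data.Product using (Σ; _×_; _,_; proj₁; proj₂)
open import Data.Sum using (_⊎_)
open import Data.Empty using (⊥)
open import Relation.Binary.PropositionalEquality using (_≡_)
open import Function.Bundles using (_⇔_)

data Formula : Set where
  var  : ℕ → Formula
  ¬'_  : Formula → Formula
  _∧'_ : Formula → Formula → Formula
  G    : Formula → Formula
  H    : Formula → Formula
  L    : Formula → Formula

record Tree : Set₁ where
  field
    T   : Set
    _<_ : T → T → Set
    irrefl : ∀ {a} → a < a → ⊥
    trans  : ∀ {a b c} → a < b → b < c → a < c
    downLinear : ∀ {a b c} → b < a → c < a → (b ≡ c) ⊎ (b < c) ⊎ (c < b)

  Subset : Set₁
  Subset = T → Set

  _⊆_ : Subset → Subset → Set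
  S ⊆ S' = ∀ x → S x → S' x

  Linear : Subset → Set
  Linear S = ∀ x y → S x → S y → (x ≡ y) ⊎ (x < y) ⊎ (y < x)

  record History : Set₁ where
    field
      mem     : Subset
      linear  : Linear mem
      maximal : (S : Subset) → Linear S → mem ⊆ S → S ⊆ mem

  open History public

  _∈_ : T → History → Set
  t ∈ h = mem h t

  _≈_ : History → History → Set
  h ≈ k = (mem h ⊆ mem k) × (mem k ⊆ mem h)

-- A frame (T,<,I).  I t is meant as an equivalence relation on H_t
-- (its values on histories not containing t are irrelevant and never used).
record Frame : Set₂ where
  field
    tree : Tree
  open Tree tree public
  field
    I : T → History → History → Set
    I-refl  : ∀ {t h} → t ∈ h → I t h h
    I-sym   : ∀ {t h k} → t ∈ h → t ∈ k → I t h k → I t k h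
    I-trans : ∀ {t h k l} → t ∈ h → t ∈ k → t ∈ l → I t h k → I t k l → I t h l
    -- histories with the same elements are the same history
    I-ext   : ∀ {t h k} → t ∈ h → t ∈ k → h ≈ k → I t h k
    I-down  : ∀ {t s h k} → t ∈ h → t ∈ k → I t h k → s < t → I s h k

  -- A couple (t,π) is represented by (t, h, t∈h) with π = [h]_{I_t}.
  Couple : Set₁
  Couple = Σ T λ t → Σ History λ h → t ∈ h

  time : Couple → T
  time (t , _ , _) = t

  _≐_ : Couple → Couple → Set
  (t , h , _) ≐ (s , k , _) = Σ (t ≡ s) λ _ → I t h k

  -- (t,π) ≺ (s,ρ) iff t < s and π ⊇ ρ
  _≺_ : Couple → Couple → Set₁
  (t , h , _) ≺ (s , k , _) =
    (t < s) × (∀ h' → s ∈ h' → I s h' k → (t ∈ h') × I t h' h)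

  _≻_ : Couple → Couple → Set₁
  x ≻ y = y ≺ x

  _∼_ : Couple → Couple → Set
  x ∼ y = time x ≡ time y

-- A model (T,<,I,V); V p is a set of couples, i.e. a predicate on
-- representatives invariant under change of representative.
record Model : Set₂ where
  field
    frame : Frame
  open Frame frame public
  field
    V : ℕ → T → History → Set
    V-resp : ∀ {p t h k} → t ∈ h → t ∈ k → I t h k → V p t h → V p t k

module _ (M : Model) where
  open Model M

  Sat : T → History → Formula → Set₁
  Sat t h (var p)   = Level.Lift _ (V p t h)
  Sat t h (¬' φ)    = Sat t h φ → ⊥
  Sat t h (φ ∧' ψ)  = Sat t h φ × Sat t h ψ
  Sat t h (G φ)     = ∀ h' → t ∈ h' → I t h' h → ∀ s → s ∈ h' → t < s → Sat s h' φ
  Sat t h (H φ)     = ∀ h' → t ∈ h' → I t h' h → ∀ s → s ∈ h' → s < t → Sat s h' φ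
  Sat t h (L φ)     = ∀ k → t ∈ k → Sat t k φ

  _⊨_ : Couple → Formula → Set₁
  (t , h , _) ⊨ φ = Sat t h φ

-- Frame p-morphisms.  f is a function on couples, so it must be well
-- defined on equivalence classes (respect ≐).
record FramePMorphism (F F' : Frame) : Set₁ where
  private
    module F  = Frame F
    module F' = Frame F'
  field
    f : F.Couple → F'.Couple
    f-wd : ∀ {x y} → x F.≐ y → f x F'.≐ f y
    G-f : ∀ {x y} → x F.≺ y → f x F'.≺ f y
    G-b : ∀ {x x'} → f x F'.≺ x' → Σ F.Couple λ y → (x F.≺ y) × (f y F'.≐ x')
    H-b : ∀ {x x'} → f x F'.≻ x' → Σ F.Couple λ y → (x F.≻ y) × (f y F'.≐ x')
    L-f : ∀ {x y} → x F.∼ y → f x F'.∼ f y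
    L-b : ∀ {x x'} → f x F'.∼ x' → Σ F.Couple λ y → (x F.∼ y) × (f y F'.≐ x')

record ModelPMorphism (M M' : Model) : Set₁ where
  private
    module M  = Model M
    module M' = Model M'
  field
    pmor : FramePMorphism M.frame M'.frame
  open FramePMorphism pmor public
  field
    PV : ∀ (x : M.Couple) (p : ℕ) →
         M.V p (proj₁ x) (proj₁ (proj₂ x))
         ⇔ M'.V p (proj₁ (f x)) (proj₁ (proj₂ (f x)))

-- Truth at a couple does not depend on the history chosen to represent it, and each of
-- G, H, L is the box modality of a relation on couples: ≺, its converse, and sameness of
-- moment.  A model p-morphism satisfies the forth and back conditions for all three relations
-- and preserves the valuation, so the zig-zag induction on formulas of basic modal logic applies.
module Submission where

open import Defs
open import Level using (_⊔_; lift; lower)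
open import Data.Product using (Σ; _×_; _,_)
open import Data.Product.Function.NonDependent.Propositional using (_×-⇔_)
open import Data.Sum using (_⊎_; inj₁; inj₂)
open import Function.Bundles using (_⇔_; mk⇔; Equivalence)
import Function.Properties.Equivalence as ⇔
open import Function.Related.TypeIsomorphisms using (¬-cong-⇔)
open import Relation.Nullary using (¬_)
open import Relation.Binary.PropositionalEquality using (_≡_; refl; sym)

□ : ∀ {a r p} {A : Set a} → (A → A → Set r) → (A → Set p) → A → Set (a ⊔ r ⊔ p)
□ R P x = ∀ y → R x y → P y

□-zigzag : ∀ {a b r r′ e p q} {A : Set a} {B : Set b}
           {_≈_ : B → B → Set e} {P : A → Set p} {Q : B → Set q}
           (R : A → A → Set r) (R′ : B → B → Set r′) (f : A → B) →
           (∀ {x y} → R x y → R′ (f x) (f y)) →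
           (∀ {x y′} → R′ (f x) y′ → Σ A λ y → R x y × f y ≈ y′) →
           (∀ y y′ → y ≈ y′ → Q y → Q y′) →
           (∀ x → P x ⇔ Q (f x)) →
           ∀ x → □ R P x ⇔ □ R′ Q (f x)
□-zigzag _ _ f forth back Q-resp P⇔Q x = mk⇔
  (λ □P y′ fxRy′ → let (y , xRy , fy≈y′) = back fxRy′ in
                   Q-resp (f y) y′ fy≈y′ (Equivalence.to (P⇔Q y) (□P y xRy)))
  (λ □Q y xRy → Equivalence.from (P⇔Q y) (□Q (f y) (forth xRy)))

module TreeProperties (Tr : Tree) where
  open Tree Tr

  -- h ∪ {t} is still linear, so maximality of h puts t in h.
  ∈-downClosed : ∀ (h : History) {s t} → s ∈ h → t < s → t ∈ h
  ∈-downClosed h {s} {t} s∈h t<s =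
    maximal h (λ x → x ∈ h ⊎ x ≡ t) linear-with-t (λ _ → inj₁) t (inj₂ refl)
    where
    comparable-with-t : ∀ x → x ∈ h → (x ≡ t) ⊎ (x < t) ⊎ (t < x)
    comparable-with-t x x∈h with linear h x s x∈h s∈h
    ... | inj₁ refl        = inj₂ (inj₂ t<s)
    ... | inj₂ (inj₁ x<s) = downLinear x<s t<s
    ... | inj₂ (inj₂ s<x) = inj₂ (inj₂ (trans t<s s<x))

    flip : ∀ {x} → (x ≡ t) ⊎ (x < t) ⊎ (t < x) → (t ≡ x) ⊎ (t < x) ⊎ (x < t)
    flip (inj₁ x≡t)        = inj₁ (sym x≡t)
    flip (inj₂ (inj₁ x<t)) = inj₂ (inj₂ x<t)
    flip (inj₂ (inj₂ t<x)) = inj₂ (inj₁ t<x)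

    linear-with-t : Linear (λ x → x ∈ h ⊎ x ≡ t)
    linear-with-t x y (inj₁ x∈h)  (inj₁ y∈h)  = linear h x y x∈h y∈h
    linear-with-t x _ (inj₁ x∈h)  (inj₂ refl) = comparable-with-t x x∈h
    linear-with-t _ y (inj₂ refl) (inj₁ y∈h)  = flip (comparable-with-t y y∈h)
    linear-with-t _ _ (inj₂ refl) (inj₂ refl) = inj₁ refl

module FrameProperties (F : Frame) where
  open Frame F
  open TreeProperties tree public

  history : Couple → History
  history (_ , h , _) = h

  ≺-intro : ∀ x y → time x < time y → time x ∈ history y →
            I (time x) (history y) (history x) → x ≺ y
  ≺-intro (_ , _ , t∈h) (_ , _ , s∈k) t<s t∈k kIh = t<s , λ k′ s∈k′ k′Ik →
    let t∈k′ = ∈-downClosed k′ s∈k′ t<s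
    in  t∈k′ , I-trans t∈k′ t∈k t∈h (I-down s∈k′ s∈k k′Ik t<s) kIh

  ≺-elim : ∀ x y → x ≺ y →
           time x < time y × Σ (time x ∈ history y) λ _ → I (time x) (history y) (history x)
  ≺-elim (_ , _ , _) (_ , _ , s∈k) (t<s , ⊇) = t<s , ⊇ _ s∈k (I-refl s∈k)

module Semantics (M : Model) where
  open Model M
  open FrameProperties frame public

  private
    infix 4 _⊩_
    _⊩_ : Couple → Formula → Set₁
    _⊩_ = _⊨_ M

  ⊨-resp-≐ : ∀ φ x y → x ≐ y → x ⊩ φ → y ⊩ φ
  ⊨-resp-≐ (var p)  (_ , _ , t∈h) (_ , _ , t∈k) (refl , hIk) (lift v) = lift (V-resp t∈h t∈k hIk v)
  ⊨-resp-≐ (¬' φ)   x@(_ , _ , t∈h) y@(_ , _ , t∈k) (refl , hIk) ¬φ φ′ =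
    ¬φ (⊨-resp-≐ φ y x (refl , I-sym t∈h t∈k hIk) φ′)
  ⊨-resp-≐ (φ ∧' ψ) x@(_ , _ , _) y@(_ , _ , _) x≐y (φ′ , ψ′) =
    ⊨-resp-≐ φ x y x≐y φ′ , ⊨-resp-≐ ψ x y x≐y ψ′
  ⊨-resp-≐ (G φ)    (_ , _ , t∈h) (_ , _ , t∈k) (refl , hIk) □φ k′ t∈k′ k′Ik =
    □φ k′ t∈k′ (I-trans t∈k′ t∈k t∈h k′Ik (I-sym t∈h t∈k hIk))
  ⊨-resp-≐ (H φ)    (_ , _ , t∈h) (_ , _ , t∈k) (refl , hIk) □φ k′ t∈k′ k′Ik =
    □φ k′ t∈k′ (I-trans t∈k′ t∈k t∈h k′Ik (I-sym t∈h t∈k hIk))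
  ⊨-resp-≐ (L φ)    (_ , _ , _) (_ , _ , _) (refl , _) □φ = □φ

  ⊨-var : ∀ x {p} → x ⊩ var p ⇔ V p (time x) (history x)
  ⊨-var (_ , _ , _) = mk⇔ lower lift

  ⊨-¬ : ∀ x {φ} → x ⊩ ¬' φ ⇔ (¬ x ⊩ φ)
  ⊨-¬ (_ , _ , _) = ⇔.refl

  ⊨-∧ : ∀ x {φ ψ} → x ⊩ φ ∧' ψ ⇔ (x ⊩ φ × x ⊩ ψ)
  ⊨-∧ (_ , _ , _) = ⇔.refl

  ⊨-G : ∀ x {φ} → x ⊩ G φ ⇔ □ _≺_ (_⊩ φ) x
  ⊨-G x@(t , h , t∈h) = mk⇔
    (λ □φ y@(s , k , s∈k) x≺y → let (t<s , t∈k , kIh) = ≺-elim x y x≺y in □φ k t∈k kIh s s∈k t<s)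
    (λ □φ k t∈k kIh s s∈k t<s → let y = (s , k , s∈k) in □φ y (≺-intro x y t<s t∈k kIh))

  -- A past moment of the couple lies on every history of its class, in particular on h.
  ⊨-H : ∀ x {φ} → x ⊩ H φ ⇔ □ _≻_ (_⊩ φ) x
  ⊨-H x@(t , h , t∈h) {φ} = mk⇔
    (λ □φ y@(s , k , s∈k) y≺x →
      let (s<t , s∈h , hIk) = ≺-elim y x y≺x
      in  ⊨-resp-≐ φ (s , h , s∈h) y (refl , hIk) (□φ h t∈h (I-refl t∈h) s s∈h s<t))
    (λ □φ k t∈k kIh s s∈k s<t →
      let y = (s , k , s∈k)
      in  □φ y (≺-intro y x s<t (∈-downClosed h t∈h s<t) (I-down t∈h t∈k (I-sym t∈k t∈h kIh) s<t)))

  ⊨-L : ∀ x {φ} → x ⊩ L φ ⇔ □ _∼_ (_⊩ φ) x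
  ⊨-L (t , h , t∈h) = mk⇔
    (λ { □φ (_ , k , t∈k) refl → □φ k t∈k })
    (λ □φ k t∈k → □φ (t , k , t∈k) refl)

mainTheorem3 : (M M' : Model) (f : ModelPMorphism M M') →
    ∀ (x : Model.Couple M) (φ : Formula) →
      _⊨_ M x φ ⇔ _⊨_ M' (ModelPMorphism.f f x) φ
mainTheorem3 M M' F = preserved
  where
  module S  = Semantics M
  module S′ = Semantics M'
  module M  = Model M
  module M′ = Model M'
  open ModelPMorphism F

  via-clauses : ∀ {a b c d} {A : Set a} {B : Set b} {C : Set c} {D : Set d} →
                A ⇔ B → C ⇔ D → B ⇔ D → A ⇔ C
  via-clauses A⇔B C⇔D B⇔D = ⇔.trans A⇔B (⇔.trans B⇔D (⇔.sym C⇔D))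

  preserved : ∀ x φ → _⊨_ M x φ ⇔ _⊨_ M' (f x) φ
  preserved x (var p)  = via-clauses (S.⊨-var x) (S′.⊨-var (f x)) (PV x p)
  preserved x (¬' φ)   = via-clauses (S.⊨-¬ x) (S′.⊨-¬ (f x)) (¬-cong-⇔ (preserved x φ))
  preserved x (φ ∧' ψ) = via-clauses (S.⊨-∧ x) (S′.⊨-∧ (f x)) (preserved x φ ×-⇔ preserved x ψ)
  preserved x (G φ)    = via-clauses (S.⊨-G x) (S′.⊨-G (f x))
    (□-zigzag M._≺_ M′._≺_ f (λ {x y} → G-f {x} {y}) (λ {x y′} → G-b {x} {y′})
              (S′.⊨-resp-≐ φ) (λ y → preserved y φ) x)
  preserved x (H φ)    = via-clauses (S.⊨-H x) (S′.⊨-H (f x))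
    (□-zigzag M._≻_ M′._≻_ f (λ {x y} → G-f {y} {x}) (λ {x y′} → H-b {x} {y′})
              (S′.⊨-resp-≐ φ) (λ y → preserved y φ) x)
  preserved x (L φ)    = via-clauses (S.⊨-L x) (S′.⊨-L (f x))
    (□-zigzag M._∼_ M′._∼_ f (λ {x y} → L-f {x} {y}) (λ {x y′} → L-b {x} {y′})
              (S′.⊨-resp-≐ φ) (λ y → preserved y φ) x)
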